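{- For every integer $k\geq 1$, the assignment \begin{align*} Z_k &\longmapsto G\binom{k}{0} - \delta_{k,2}\, G\binom{2}{0},\\ Z_{k_1,k_2} &\longmapsto G\binom{k_1,k_2}{0,0} + \frac{1}{2}\left( \delta_{k_2,1}\, G\binom{k_1}{1} - \delta_{k_1,1}\, G\binom{k_2}{1} + \delta_{k_1,2}\, G\binom{k_2+1}{1}\right),\\ P_{k_1,k_2} &\longmapsto P\binom{k_1,k_2}{0,0} + \frac{1}{2}\left( \delta_{k_1,2}\, G\binom{k_2+1}{1} + \delta_{k_2,2}\, G\binom{k_1+1}{1}\right) - \delta_{k_1 k_2,1}\, G\binom{2}{0} \end{align*} (for all $k_1,k_2\geq 1$ with $k_1+k_2=k$) gives a well-defined $\mathbb{Q}$-linear map $\mathcal{DZ}_k \to \mathcal{DE}_k$.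
   Context: $\delta_{a,b}$ is the Kronecker delta; binomial coefficients $\binom{n}{m}$ are taken to be $0$ unless $0\le m\le n$. The formal double zeta space of weight $k\ge 1$ is the $\mathbb{Q}$-vector space $\mathcal{DZ}_k$ spanned by formal symbols $Z_k$, $Z_{k_1,k_2}$, $P_{k_1,k_2}$ ($k_1+k_2=k$, $k_1,k_2\ge1$) modulo the relations, for all such $k_1,k_2$: $$P_{k_1,k_2} = Z_{k_1,k_2}+Z_{k_2,k_1}+Z_{k_1+k_2} = \sum_{j=1}^{k_1+k_2-1}\left(\binom{j-1}{k_1-1}+\binom{j-1}{k_2-1}\right) Z_{j,k_1+k_2-j}.$$ The formal double Eisenstein space of weight $K\ge1$ is the $\mathbb{Q}$-vector space $\mathcal{DE}_K$ spanned by formal symbols $G\binom{k}{d}$, $G\binom{k_1,k_2}{d_1,d_2}$, $P\binom{k_1,k_2}{d_1,d_2}$ with $k+d=k_1+k_2+d_1+d_2=K$, $k,k_1,k_2\ge1$, $d,d_1,d_2\ge0$, modulo the relations, for all such $k_1,k_2,d_1,d_2$: \begin{align*} P\binom{k_1,k_2}{d_1,d_2} &= G\binom{k_1,k_2}{d_1,d_2}+G\binom{k_2,k_1}{d_2,d_1}+G\binom{k_1+k_2}{d_1+d_2}\\ &= \sum_{\substack{l_1+l_2=k_1+k_2,\ e_1+e_2=d_1+d_2\\ l_1,l_2\ge1,\ e_1,e_2\ge0}}\left(\binom{l_1-1}{k_1-1}\binom{d_1}{e_1}(-1)^{d_1-e_1}+\binom{l_1-1}{k_2-1}\binom{d_2}{e_1}(-1)^{d_2-e_1}\right)G\binom{l_1,l_2}{e_1,e_2}\\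 &\quad+\frac{d_1!\,d_2!}{(d_1+d_2+1)!}\binom{k_1+k_2-2}{k_1-1}G\binom{k_1+k_2-1}{d_1+d_2+1}. \end{align*} Here $G\binom{a}{b}$ denotes the symbol with upper index $a$ and lower index $b$ (not a binomial coefficient). -}

module Defs where

open import Data.Nat as ℕ using (ℕ; zero; suc; _∸_; _≤_; _!; _≡ᵇ_)
open import Data.Nat.Properties using (_!≢0)
open import Data.Nat.Combinatorics using (_C_)
open import Data.Integer as ℤ using (ℤ; +_)
open import Data.Rational as ℚ using (ℚ; 0ℚ; 1ℚ; ½; _/_)
open import Data.Bool using (Bool; true; false; if_then_else_; _∧_)
open import Data.List using (List; []; _∷_; map; concatMap; upTo; _++_)
open import Data.List.Relation.Unary.All using (All)
open import Data.Product using (Σ; _×_; _,_; proj₂)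
open import Relation.Binary.PropositionalEquality using (_≡_)
open import Relation.Nullary using (¬_)

Formal : Set → Set
Formal A = List (ℚ × A)

scale : {A : Set} → ℚ → Formal A → Formal A
scale c = map (λ { (a , g) → (c ℚ.* a , g) })

coeffWith : {A : Set} → (A → A → Bool) → A → Formal A → ℚ
coeffWith eq g [] = 0ℚ
coeffWith eq g ((c , h) ∷ v) = (if eq g h then c else 0ℚ) ℚ.+ coeffWith eq g v

δ : ℕ → ℕ → ℚ
δ a b = if a ≡ᵇ b then 1ℚ else 0ℚ

binom : ℕ → ℕ → ℤ
binom n m = + (n C m)

sgn : ℕ → ℤ
sgn zero = + 1
sgn (suc n) = ℤ.- sgn n

range : ℕ → ℕ → List ℕ
range a n = map (a ℕ.+_) (upTo n)

data ZGen : Set where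
  Z₁ : ℕ → ZGen
  Z₂ : ℕ → ℕ → ZGen
  Pᶻ : ℕ → ℕ → ZGen

data EGen : Set where
  G₁ : ℕ → ℕ → EGen
  G₂ : ℕ → ℕ → ℕ → ℕ → EGen
  Pᵉ : ℕ → ℕ → ℕ → ℕ → EGen

eqE : EGen → EGen → Bool
eqE (G₁ a b) (G₁ a' b') = (a ≡ᵇ a') ∧ (b ≡ᵇ b')
eqE (G₂ a b c d) (G₂ a' b' c' d') = (a ≡ᵇ a') ∧ (b ≡ᵇ b') ∧ (c ≡ᵇ c') ∧ (d ≡ᵇ d')
eqE (Pᵉ a b c d) (Pᵉ a' b' c' d') = (a ≡ᵇ a') ∧ (b ≡ᵇ b') ∧ (c ≡ᵇ c') ∧ (d ≡ᵇ d')
eqE _ _ = false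

coeffE : EGen → Formal EGen → ℚ
coeffE = coeffWith eqE

ValidEGen : ℕ → EGen → Set
ValidEGen K (G₁ k d) = (1 ≤ k) × (k ℕ.+ d ≡ K)
ValidEGen K (G₂ k₁ k₂ d₁ d₂) = (1 ≤ k₁) × (1 ≤ k₂) × (k₁ ℕ.+ k₂ ℕ.+ d₁ ℕ.+ d₂ ≡ K)
ValidEGen K (Pᵉ k₁ k₂ d₁ d₂) = (1 ≤ k₁) × (1 ≤ k₂) × (k₁ ℕ.+ k₂ ℕ.+ d₁ ℕ.+ d₂ ≡ K)

ValidZGen : ℕ → ZGen → Set
ValidZGen k (Z₁ k') = k' ≡ k
ValidZGen k (Z₂ k₁ k₂) = (1 ≤ k₁) × (1 ≤ k₂) × (k₁ ℕ.+ k₂ ≡ k)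
ValidZGen k (Pᶻ k₁ k₂) = (1 ≤ k₁) × (1 ≤ k₂) × (k₁ ℕ.+ k₂ ≡ k)

-- Defining relations of 𝒟𝒵_k, written as elements "lhs - rhs" of the
-- free vector space (for k₁, k₂ ≥ 1).

zRel₁ : ℕ → ℕ → Formal ZGen
zRel₁ k₁ k₂ =
  (1ℚ , Pᶻ k₁ k₂) ∷ (ℚ.- 1ℚ , Z₂ k₁ k₂) ∷ (ℚ.- 1ℚ , Z₂ k₂ k₁) ∷ (ℚ.- 1ℚ , Z₁ (k₁ ℕ.+ k₂)) ∷ []

zRel₂ : ℕ → ℕ → Formal ZGen
zRel₂ k₁ k₂ = (1ℚ , Pᶻ k₁ k₂) ∷ map term (range 1 (k₁ ℕ.+ k₂ ∸ 1))
  where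
  term : ℕ → ℚ × ZGen
  term j = (ℚ.- ((binom (j ∸ 1) (k₁ ∸ 1) ℤ.+ binom (j ∸ 1) (k₂ ∸ 1)) / 1) , Z₂ j (k₁ ℕ.+ k₂ ∸ j))

eRel₁ : ℕ → ℕ → ℕ → ℕ → Formal EGen
eRel₁ k₁ k₂ d₁ d₂ =
  (1ℚ , Pᵉ k₁ k₂ d₁ d₂) ∷ (ℚ.- 1ℚ , G₂ k₁ k₂ d₁ d₂) ∷ (ℚ.- 1ℚ , G₂ k₂ k₁ d₂ d₁)
    ∷ (ℚ.- 1ℚ , G₁ (k₁ ℕ.+ k₂) (d₁ ℕ.+ d₂)) ∷ []

eRel₂ : ℕ → ℕ → ℕ → ℕ → Formal EGen
eRel₂ k₁ k₂ d₁ d₂ =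
  (1ℚ , Pᵉ k₁ k₂ d₁ d₂)
    ∷ (concatMap (λ l₁ → map (term l₁) (range 0 (suc (d₁ ℕ.+ d₂)))) (range 1 (k₁ ℕ.+ k₂ ∸ 1))
       ++ ((ℚ.- lastCoeff , G₁ (k₁ ℕ.+ k₂ ∸ 1) (suc (d₁ ℕ.+ d₂))) ∷ []))
  where
  coef : ℕ → ℕ → ℤ
  coef l₁ e₁ = binom (l₁ ∸ 1) (k₁ ∸ 1) ℤ.* binom d₁ e₁ ℤ.* sgn (d₁ ∸ e₁)
               ℤ.+ binom (l₁ ∸ 1) (k₂ ∸ 1) ℤ.* binom d₂ e₁ ℤ.* sgn (d₂ ∸ e₁)
  term : ℕ → ℕ → ℚ × EGen
  term l₁ e₁ = (ℚ.- (coef l₁ e₁ / 1) , G₂ l₁ (k₁ ℕ.+ k₂ ∸ l₁) e₁ (d₁ ℕ.+ d₂ ∸ e₁))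
  lastCoeff : ℚ
  lastCoeff = (+ (d₁ ! ℕ.* d₂ ! ℕ.* ((k₁ ℕ.+ k₂ ∸ 2) C (k₁ ∸ 1))) / (suc (d₁ ℕ.+ d₂)) !)
    {{suc (d₁ ℕ.+ d₂) !≢0}}

data Which : Set where
  first second : Which

record ERelIdx : Set where
  constructor erel
  field
    which : Which
    k₁ k₂ d₁ d₂ : ℕ

ValidERel : ℕ → ERelIdx → Set
ValidERel K (erel _ k₁ k₂ d₁ d₂) = (1 ≤ k₁) × (1 ≤ k₂) × (k₁ ℕ.+ k₂ ℕ.+ d₁ ℕ.+ d₂ ≡ K)

eRel : ERelIdx → Formal EGen
eRel (erel first k₁ k₂ d₁ d₂) = eRel₁ k₁ k₂ d₁ d₂
eRel (erel second k₁ k₂ d₁ d₂) = eRel₂ k₁ k₂ d₁ d₂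

InRelSpanE : ℕ → Formal EGen → Set
InRelSpanE K v =
  Σ (List (ℚ × ERelIdx)) λ cs →
    All (λ p → ValidERel K (proj₂ p)) cs ×
    (∀ g → coeffE g v ≡ coeffE g (concatMap (λ { (c , r) → scale c (eRel r) }) cs))

φ : ZGen → Formal EGen
φ (Z₁ k) = (1ℚ , G₁ k 0) ∷ (ℚ.- δ k 2 , G₁ 2 0) ∷ []
φ (Z₂ k₁ k₂) =
  (1ℚ , G₂ k₁ k₂ 0 0)
    ∷ (½ ℚ.* δ k₂ 1 , G₁ k₁ 1)
    ∷ (ℚ.- (½ ℚ.* δ k₁ 1) , G₁ k₂ 1)
    ∷ (½ ℚ.* δ k₁ 2 , G₁ (suc k₂) 1) ∷ []
φ (Pᶻ k₁ k₂) =
  (1ℚ , Pᵉ k₁ k₂ 0 0)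
    ∷ (½ ℚ.* δ k₁ 2 , G₁ (suc k₂) 1)
    ∷ (½ ℚ.* δ k₂ 2 , G₁ (suc k₁) 1)
    ∷ (ℚ.- δ (k₁ ℕ.* k₂) 1 , G₁ 2 0) ∷ []

φ* : Formal ZGen → Formal EGen
φ* = concatMap (λ { (c , g) → scale c (φ g) })

{-# OPTIONS --safe #-}
-- Everything is checked coefficientwise. Every correction term of φ carries a Kronecker delta
-- that forces its symbol to have weight k, so images of weight-k symbols stay in weight k.
-- Each relation of 𝒟𝒵_k is sent to a single relation of 𝒟ℰ_k with d₁ = d₂ = 0: the first to
-- the first, the second to the second (to the first when k₁ = k₂ = 1). For the second one the
-- G(j,k-j)-terms agree, and the corrections in φ(Z_{j,k-j}) survive only for j = 1, 2, k-1,
-- all at G(k-1;1); as C(1,k₁-1) - C(0,k₁-1) = δ_{k₁,2}, together with the corrections of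
-- φ(P_{k₁,k₂}) they add up to the term -C(k-2,k₁-1) G(k-1;1) of the Eisenstein relation.
module Submission where

open import Algebra.Bundles using (CommutativeMonoid)
open import Data.Bool using (Bool; true; false; T; if_then_else_; _∧_)
open import Data.Bool.Properties using (T-∧)
open import Data.Empty using (⊥-elim)
import Data.Integer as ℤ
import Data.Integer.Properties as ℤP
open import Data.List using (List; []; _∷_; map; concatMap; _++_; applyUpTo)
open import Data.List.Properties using (map-upTo; ++-identityʳ)
open import Data.List.Relation.Unary.All as All using (All)
open import Data.Nat as ℕ using (ℕ; zero; suc; _+_; _*_; _∸_; _≤_; _<_; s≤s; z≤n; _≡ᵇ_)
import Data.Nat.Properties as ℕP
open import Data.Nat.Combinatorics using (_C_; nCk≡nC[n∸k])
open import Data.Nat.Coprimality using (gcd≡1⇒coprime)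
open import Data.Nat.GCD using (gcd-zeroʳ)
open import Data.Product using (_×_; _,_)
open import Data.Rational as ℚ using (ℚ; 0ℚ; 1ℚ; ½; _/_)
import Data.Rational.Properties as ℚP
open import Data.Sum using (_⊎_; inj₁; inj₂; [_,_])
open import Function using (_∘_; id; Equivalence)
open import Level using (0ℓ)
open import Relation.Binary.PropositionalEquality hiding ([_])
open import Relation.Nullary using (¬_; yes; no)
open import Relation.Nullary.Decidable.Core using (dec⇒maybe)
open import Tactic.RingSolver using (solve)
open import Tactic.RingSolver.Core.AlmostCommutativeRing using (AlmostCommutativeRing; fromCommutativeRing)

open import Defs

open import Algebra.Properties.CommutativeSemigroup
  (CommutativeMonoid.commutativeSemigroup ℚP.+-0-commutativeMonoid) using (interchange)

ℚ-ring : AlmostCommutativeRing 0ℓ 0ℓ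
ℚ-ring = fromCommutativeRing ℚP.+-*-commutativeRing (λ x → dec⇒maybe (0ℚ ℚ.≟ x))

𝟙 : Bool → ℚ
𝟙 b = if b then 1ℚ else 0ℚ

-- coeffE with every summand a product, so that coefficients unfold to ring expressions
coeff : EGen → Formal EGen → ℚ
coeff g [] = 0ℚ
coeff g ((c , h) ∷ v) = c ℚ.* 𝟙 (eqE g h) ℚ.+ coeff g v

if-then-0≡*𝟙 : ∀ b c → (if b then c else 0ℚ) ≡ c ℚ.* 𝟙 b
if-then-0≡*𝟙 true c = sym (ℚP.*-identityʳ c)
if-then-0≡*𝟙 false c = sym (ℚP.*-zeroʳ c)

coeffE≡coeff : ∀ g v → coeffE g v ≡ coeff g v
coeffE≡coeff g [] = refl
coeffE≡coeff g ((c , h) ∷ v) = cong₂ ℚ._+_ (if-then-0≡*𝟙 (eqE g h) c) (coeffE≡coeff g v)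

coeff-++ : ∀ g v w → coeff g (v ++ w) ≡ coeff g v ℚ.+ coeff g w
coeff-++ g [] w = sym (ℚP.+-identityˡ (coeff g w))
coeff-++ g ((c , h) ∷ v) w = trans (cong (c ℚ.* 𝟙 (eqE g h) ℚ.+_) (coeff-++ g v w))
  (sym (ℚP.+-assoc (c ℚ.* 𝟙 (eqE g h)) (coeff g v) (coeff g w)))

coeff-scale : ∀ g c v → coeff g (scale c v) ≡ c ℚ.* coeff g v
coeff-scale g c [] = sym (ℚP.*-zeroʳ c)
coeff-scale g c ((a , h) ∷ v) = begin
  c ℚ.* a ℚ.* 𝟙 (eqE g h) ℚ.+ coeff g (scale c v)   ≡⟨ cong₂ ℚ._+_ (ℚP.*-assoc c a _) (coeff-scale g c v) ⟩
  c ℚ.* (a ℚ.* 𝟙 (eqE g h)) ℚ.+ c ℚ.* coeff g v     ≡⟨ ℚP.*-distribˡ-+ c _ _ ⟨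
  c ℚ.* (a ℚ.* 𝟙 (eqE g h) ℚ.+ coeff g v)           ∎
  where open ≡-Reasoning

∑ : {A : Set} → (A → ℚ) → List A → ℚ
∑ f [] = 0ℚ
∑ f (x ∷ xs) = f x ℚ.+ ∑ f xs

∑-map : {A B : Set} (f : B → ℚ) (h : A → B) (xs : List A) → ∑ f (map h xs) ≡ ∑ (f ∘ h) xs
∑-map f h [] = refl
∑-map f h (x ∷ xs) = cong (f (h x) ℚ.+_) (∑-map f h xs)

∑-cong : {A : Set} {f h : A → ℚ} → (∀ x → f x ≡ h x) → ∀ xs → ∑ f xs ≡ ∑ h xs
∑-cong f≗h [] = refl
∑-cong f≗h (x ∷ xs) = cong₂ ℚ._+_ (f≗h x) (∑-cong f≗h xs)

∑-+ : {A : Set} (f h : A → ℚ) (xs : List A) → ∑ (λ x → f x ℚ.+ h x) xs ≡ ∑ f xs ℚ.+ ∑ h xs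
∑-+ f h [] = refl
∑-+ f h (x ∷ xs) =
  trans (cong (f x ℚ.+ h x ℚ.+_) (∑-+ f h xs)) (interchange (f x) (h x) (∑ f xs) (∑ h xs))

coeff-concatMap : {A : Set} → ∀ g (f : A → Formal EGen) xs → coeff g (concatMap f xs) ≡ ∑ (coeff g ∘ f) xs
coeff-concatMap g f [] = refl
coeff-concatMap g f (x ∷ xs) =
  trans (coeff-++ g (f x) (concatMap f xs)) (cong (coeff g (f x) ℚ.+_) (coeff-concatMap g f xs))

termCoeff : EGen → ℚ × ZGen → ℚ
termCoeff g (c , z) = coeff g (scale c (φ z))

coeff-φ* : ∀ g v → coeff g (φ* v) ≡ ∑ (termCoeff g) v
coeff-φ* g v = trans (coeff-concatMap g _ v) (∑-cong (λ { (c , z) → refl }) v)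

∑-applyUpTo-zero : ∀ (F : ℕ → ℚ) f m → (∀ j → F (f j) ≡ 0ℚ) → ∑ F (applyUpTo f m) ≡ 0ℚ
∑-applyUpTo-zero F f zero F∘f≡0 = refl
∑-applyUpTo-zero F f (suc m) F∘f≡0 =
  cong₂ ℚ._+_ (F∘f≡0 0) (∑-applyUpTo-zero F (f ∘ suc) m (F∘f≡0 ∘ suc))

∑-applyUpTo-single : ∀ (F : ℕ → ℚ) f m i → (∀ j → j ≢ i → F (f j) ≡ 0ℚ) → i < m →
  ∑ F (applyUpTo f m) ≡ F (f i)
∑-applyUpTo-single F f (suc m) zero off-i _ = trans
  (cong (F (f 0) ℚ.+_) (∑-applyUpTo-zero F (f ∘ suc) m (λ j → off-i (suc j) λ ())))
  (ℚP.+-identityʳ (F (f 0)))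
∑-applyUpTo-single F f (suc m) (suc i) off-i (s≤s i<m) = trans
  (cong₂ ℚ._+_ (off-i 0 λ ()) (∑-applyUpTo-single F (f ∘ suc) m i (λ j j≢i → off-i (suc j) (j≢i ∘ ℕP.suc-injective)) i<m))
  (ℚP.+-identityˡ (F (f (suc i))))

∑-range-single : ∀ (F : ℕ → ℚ) a m i → (∀ j → j ≢ i → F (a + j) ≡ 0ℚ) → i < m →
  ∑ F (range a m) ≡ F (a + i)
∑-range-single F a m i off-i i<m =
  trans (cong (∑ F) (map-upTo (a +_) m)) (∑-applyUpTo-single F (a +_) m i off-i i<m)

inRelSpan-single : ∀ {K} v r → ValidERel K r → (∀ g → coeff g v ≡ coeff g (eRel r)) → InRelSpanE K v
inRelSpan-single v r valid v≈r = (1ℚ , r) ∷ [] , valid All.∷ All.[] , λ g → begin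
  coeffE g v                          ≡⟨ coeffE≡coeff g v ⟩
  coeff g v                           ≡⟨ v≈r g ⟩
  coeff g (eRel r)                    ≡⟨ ℚP.*-identityˡ (coeff g (eRel r)) ⟨
  1ℚ ℚ.* coeff g (eRel r)             ≡⟨ coeff-scale g 1ℚ (eRel r) ⟨
  coeff g (scale 1ℚ (eRel r))         ≡⟨ cong (coeff g) (++-identityʳ (scale 1ℚ (eRel r))) ⟨
  coeff g (scale 1ℚ (eRel r) ++ [])   ≡⟨ coeffE≡coeff g (scale 1ℚ (eRel r) ++ []) ⟨
  coeffE g (scale 1ℚ (eRel r) ++ [])  ∎
  where open ≡-Reasoning

δ-≢ : ∀ {a b} → a ≢ b → δ a b ≡ 0ℚ
δ-≢ {a} {b} a≢b with a ≡ᵇ b in eq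
... | true = ⊥-elim (a≢b (ℕP.≡ᵇ⇒≡ a b (subst T (sym eq) _)))
... | false = refl

δ-guarded : ∀ {P : Set} (f : ℚ → ℚ) → f 0ℚ ≡ 0ℚ → ∀ a b → (a ≡ b → P) → f (δ a b) ≡ 0ℚ ⊎ P
δ-guarded f f0≡0 a b a≡b⇒P with a ℕ.≟ b
... | yes a≡b = inj₂ (a≡b⇒P a≡b)
... | no a≢b = inj₁ (trans (cong f (δ-≢ a≢b)) f0≡0)

δ-cong : ∀ s a b {x y} → (a ≡ b → x ≡ y) → s ℚ.* δ a b ℚ.* x ≡ s ℚ.* δ a b ℚ.* y
δ-cong s a b {x} {y} a≡b⇒x≡y with a ℕ.≟ b
... | yes a≡b = cong (s ℚ.* δ a b ℚ.*_) (a≡b⇒x≡y a≡b)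
... | no a≢b rewrite δ-≢ a≢b | ℚP.*-zeroʳ s = trans (ℚP.*-zeroˡ x) (sym (ℚP.*-zeroˡ y))

-- both sides are 1 exactly when k₁ = k₂ = 1
δ-*≡δ-+ : ∀ p q → δ (suc p * suc q) 1 ≡ δ (suc p + suc q) 2
δ-*≡δ-+ zero zero = refl
δ-*≡δ-+ zero (suc q) = refl
δ-*≡δ-+ (suc zero) zero = refl
δ-*≡δ-+ (suc (suc p)) zero = refl
δ-*≡δ-+ (suc zero) (suc q) = refl
δ-*≡δ-+ (suc (suc p)) (suc q) = refl

≡ᵇ-∧ : ∀ a b {r} → T ((a ≡ᵇ b) ∧ r) → a ≡ b × T r
≡ᵇ-∧ a b t = let (a≡ᵇb , tr) = Equivalence.to T-∧ t in ℕP.≡ᵇ⇒≡ a b a≡ᵇb , tr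

eqE-sound : ∀ g h → T (eqE g h) → g ≡ h
eqE-sound (G₁ a b) (G₁ a' b') t with ≡ᵇ-∧ a a' t
... | refl , t′ rewrite ℕP.≡ᵇ⇒≡ b b' t′ = refl
eqE-sound (G₂ a b c d) (G₂ a' b' c' d') t with ≡ᵇ-∧ a a' t
... | refl , t₁ with ≡ᵇ-∧ b b' t₁
... | refl , t₂ with ≡ᵇ-∧ c c' t₂
... | refl , t₃ rewrite ℕP.≡ᵇ⇒≡ d d' t₃ = refl
eqE-sound (Pᵉ a b c d) (Pᵉ a' b' c' d') t with ≡ᵇ-∧ a a' t
... | refl , t₁ with ≡ᵇ-∧ b b' t₁
... | refl , t₂ with ≡ᵇ-∧ c c' t₂
... | refl , t₃ rewrite ℕP.≡ᵇ⇒≡ d d' t₃ = refl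

coeffE-supported : (P : EGen → Set) {h : EGen} → ¬ P h →
  ∀ v → All (λ { (c , e) → c ≡ 0ℚ ⊎ P e }) v → coeffE h v ≡ 0ℚ
coeffE-supported P ¬Ph [] All.[] = refl
coeffE-supported P {h} ¬Ph ((c , e) ∷ v) (c≡0⊎Pe All.∷ rest) =
  cong₂ ℚ._+_ leading (coeffE-supported P ¬Ph v rest)
  where
  leading : (if eqE h e then c else 0ℚ) ≡ 0ℚ
  leading with eqE h e in eq
  ... | false = refl
  ... | true = [ id , (λ Pe → ⊥-elim (¬Ph (subst P (sym (eqE-sound h e (subst T (sym eq) _))) Pe))) ] c≡0⊎Pe

+0+0 : ∀ m → m + 0 + 0 ≡ m
+0+0 m = trans (ℕP.+-identityʳ (m + 0)) (ℕP.+-identityʳ m)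

φ-supported : ∀ {k} → 1 ≤ k → ∀ g → ValidZGen k g →
  All (λ { (c , e) → c ≡ 0ℚ ⊎ ValidEGen k e }) (φ g)
φ-supported 1≤k (Z₁ k) refl =
  inj₂ (1≤k , ℕP.+-identityʳ k) All.∷ δ-guarded ℚ.-_ refl k 2 (λ { refl → s≤s z≤n , refl }) All.∷ All.[]
φ-supported _ (Z₂ k₁ k₂) (1≤k₁ , 1≤k₂ , refl) =
  inj₂ (1≤k₁ , 1≤k₂ , +0+0 (k₁ + k₂))
  All.∷ δ-guarded (½ ℚ.*_) refl k₂ 1 (λ { refl → 1≤k₁ , refl })
  All.∷ δ-guarded (λ x → ℚ.- (½ ℚ.* x)) refl k₁ 1 (λ { refl → 1≤k₂ , ℕP.+-comm k₂ 1 })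
  All.∷ δ-guarded (½ ℚ.*_) refl k₁ 2 (λ { refl → s≤s z≤n , cong suc (ℕP.+-comm k₂ 1) })
  All.∷ All.[]
φ-supported _ (Pᶻ k₁ k₂) (1≤k₁ , 1≤k₂ , refl) =
  inj₂ (1≤k₁ , 1≤k₂ , +0+0 (k₁ + k₂))
  All.∷ δ-guarded (½ ℚ.*_) refl k₁ 2 (λ { refl → s≤s z≤n , cong suc (ℕP.+-comm k₂ 1) })
  All.∷ δ-guarded (½ ℚ.*_) refl k₂ 2 (λ { refl → s≤s z≤n , sym (ℕP.+-suc k₁ 1) })
  All.∷ δ-guarded ℚ.-_ refl (k₁ * k₂) 1
      (λ k₁k₂≡1 → s≤s z≤n , sym (cong₂ _+_ (ℕP.m*n≡1⇒m≡1 k₁ k₂ k₁k₂≡1) (ℕP.m*n≡1⇒n≡1 k₁ k₂ k₁k₂≡1)))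
  All.∷ All.[]

φ*-zRel₁ : ∀ p q g → coeff g (φ* (zRel₁ (suc p) (suc q))) ≡ coeff g (eRel₁ (suc p) (suc q) 0 0)
φ*-zRel₁ p q g rewrite δ-*≡δ-+ p q
  with 𝟙 (eqE g (Pᵉ (suc p) (suc q) 0 0)) | 𝟙 (eqE g (G₂ (suc p) (suc q) 0 0)) | 𝟙 (eqE g (G₂ (suc q) (suc p) 0 0))
     | 𝟙 (eqE g (G₁ (suc p + suc q) 0)) | 𝟙 (eqE g (G₁ 2 0))
     | 𝟙 (eqE g (G₁ (suc p) 1)) | 𝟙 (eqE g (G₁ (suc q) 1)) | 𝟙 (eqE g (G₁ (suc (suc p)) 1)) | 𝟙 (eqE g (G₁ (suc (suc q)) 1))
     | δ (suc p) 1 | δ (suc q) 1 | δ (suc p) 2 | δ (suc q) 2 | δ (suc p + suc q) 2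
... | ιP | ι₁₂ | ι₂₁ | ιK | ι₂ | ι₁ | ι₁′ | ι₁₊ | ι₂₊ | d₁ | d₂ | e₁ | e₂ | eK =
  solve (ιP ∷ ι₁₂ ∷ ι₂₁ ∷ ιK ∷ ι₂ ∷ ι₁ ∷ ι₁′ ∷ ι₁₊ ∷ ι₂₊ ∷ d₁ ∷ d₂ ∷ e₁ ∷ e₂ ∷ eK ∷ []) ℚ-ring

φ*-zRel₂-1-1 : ∀ g → coeff g (φ* (zRel₂ 1 1)) ≡ coeff g (eRel₁ 1 1 0 0)
φ*-zRel₂-1-1 g
  with 𝟙 (eqE g (Pᵉ 1 1 0 0)) | 𝟙 (eqE g (G₂ 1 1 0 0)) | 𝟙 (eqE g (G₁ 2 0)) | 𝟙 (eqE g (G₁ 1 1)) | 𝟙 (eqE g (G₁ 2 1))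
... | ιP | ι₁₁ | ι₂ | ι₁ | ι₂₁ = solve (ιP ∷ ι₁₁ ∷ ι₂ ∷ ι₁ ∷ ι₂₁ ∷ []) ℚ-ring

fromℕ : ℕ → ℚ
fromℕ m = ℤ.+ m / 1

fromℕ≡mkℚ : ∀ m → fromℕ m ≡ ℚ.mkℚ (ℤ.+ m) 0 (gcd≡1⇒coprime (gcd-zeroʳ m))
fromℕ≡mkℚ m = ℚP.normalize-coprime (gcd≡1⇒coprime (gcd-zeroʳ m))

fromℕ-+ : ∀ a b → fromℕ (a + b) ≡ fromℕ a ℚ.+ fromℕ b
fromℕ-+ a b = begin
  ℤ.+ (a + b) / 1                              ≡⟨ ℚP./-cong (cong₂ ℤ._+_ (ℤP.*-identityʳ (ℤ.+ a)) (ℤP.*-identityʳ (ℤ.+ b))) refl ⟨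
  (ℤ.+ a ℤ.* ℤ.+ 1 ℤ.+ ℤ.+ b ℤ.* ℤ.+ 1) / 1    ≡⟨ cong₂ ℚ._+_ (fromℕ≡mkℚ a) (fromℕ≡mkℚ b) ⟨
  fromℕ a ℚ.+ fromℕ b                          ∎
  where open ≡-Reasoning

fromℕ-1Cp : ∀ p → fromℕ (1 C p) ≡ fromℕ (0 C p) ℚ.+ δ (suc p) 2
fromℕ-1Cp zero = refl
fromℕ-1Cp (suc zero) = refl
fromℕ-1Cp (suc (suc p)) = refl

∸≡1⇒≡suc : ∀ m j → m ∸ j ≡ 1 → m ≡ suc j
∸≡1⇒≡suc (suc m) zero m≡0 = m≡0
∸≡1⇒≡suc (suc m) (suc j) m∸j≡1 = cong suc (∸≡1⇒≡suc m j m∸j≡1)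

δ-term-vanishes : ∀ x y (f : ℚ → ℚ) → f 0ℚ ≡ 0ℚ → ∀ {a b} → a ≢ b → x ℚ.* f (δ a b) ℚ.* y ≡ 0ℚ
δ-term-vanishes x y f f0≡0 a≢b rewrite δ-≢ a≢b | f0≡0 = trans (cong (ℚ._* y) (ℚP.*-zeroʳ x)) (ℚP.*-zeroˡ y)

-- the comparison of G(k-1;1)-coefficients in the second relation, with bⱼ = β j and dᵢ = δ_{kᵢ,2}
boundary-cancel : ∀ ιP ιN ι₂₀ S d₁ d₂ b₁ b₂ bₙ c → bₙ ≡ c ℚ.+ c → b₂ ≡ b₁ ℚ.+ (d₁ ℚ.+ d₂) →
  (1ℚ ℚ.* ιP ℚ.+ (½ ℚ.* d₁ ℚ.* ιN ℚ.+ (½ ℚ.* d₂ ℚ.* ιN ℚ.+ (ℚ.- 0ℚ ℚ.* ι₂₀ ℚ.+ 0ℚ))))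
    ℚ.+ (S ℚ.+ (ℚ.- bₙ ℚ.* ½ ℚ.* ιN ℚ.+ (ℚ.- b₁ ℚ.* ℚ.- ½ ℚ.* ιN ℚ.+ ℚ.- b₂ ℚ.* ½ ℚ.* ιN)))
  ≡ 1ℚ ℚ.* ιP ℚ.+ (S ℚ.+ ℚ.- c ℚ.* ιN)
boundary-cancel ιP ιN ι₂₀ S d₁ d₂ b₁ _ _ c refl refl =
  solve (ιP ∷ ιN ∷ ι₂₀ ∷ S ∷ d₁ ∷ d₂ ∷ b₁ ∷ c ∷ []) ℚ-ring

-- k₁ = p + 1, k₂ = q + 1 and n = k - 1. β j is minus the coefficient of Z_{j,k-j} in zRel₂, and
-- pairPart, lastIs1, firstIs1, firstIs2 are the coefficients of g in the four terms of its image,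
-- those carrying δ_{k-j,1}, δ_{j,1} and δ_{j,2} being nonzero only for j = n, 1 and 2.
module _ (p q : ℕ) (g : EGen) where
  private
    k₁ k₂ K n : ℕ
    k₁ = suc p
    k₂ = suc q
    K = k₁ + k₂
    n = p + k₂

    R : List ℕ
    R = range 1 n

    ι : EGen → ℚ
    ι h = 𝟙 (eqE g h)

    β : ℕ → ℚ
    β j = (binom (j ∸ 1) p ℤ.+ binom (j ∸ 1) q) / 1

    c : ℚ
    c = fromℕ ((K ∸ 2) C p)

    zetaTerm : ℕ → ℚ × ZGen
    zetaTerm j = ℚ.- β j , Z₂ j (K ∸ j)

    pairPart lastIs1 firstIs1 firstIs2 : ℕ → ℚ
    pairPart j = ℚ.- β j ℚ.* 1ℚ ℚ.* ι (G₂ j (K ∸ j) 0 0)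
    lastIs1 j = ℚ.- β j ℚ.* (½ ℚ.* δ (K ∸ j) 1) ℚ.* ι (G₁ j 1)
    firstIs1 j = ℚ.- β j ℚ.* ℚ.- (½ ℚ.* δ j 1) ℚ.* ι (G₁ (K ∸ j) 1)
    firstIs2 j = ℚ.- β j ℚ.* (½ ℚ.* δ j 2) ℚ.* ι (G₁ (suc (K ∸ j)) 1)

    n≡1+[p+q] : n ≡ suc (p + q)
    n≡1+[p+q] = ℕP.+-suc p q

    K∸2≡p+q : K ∸ 2 ≡ p + q
    K∸2≡p+q = cong (_∸ 1) n≡1+[p+q]

    coeff-φ*-zRel₂ : coeff g (φ* (zRel₂ k₁ k₂))
      ≡ coeff g (φ (Pᶻ k₁ k₂)) ℚ.+ (∑ pairPart R ℚ.+ (∑ lastIs1 R ℚ.+ (∑ firstIs1 R ℚ.+ ∑ firstIs2 R)))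
    coeff-φ*-zRel₂ = begin
      coeff g (φ* (zRel₂ k₁ k₂))
        ≡⟨ coeff-φ* g (zRel₂ k₁ k₂) ⟩
      coeff g (scale 1ℚ (φ (Pᶻ k₁ k₂))) ℚ.+ ∑ (termCoeff g) (map zetaTerm R)
        ≡⟨ cong₂ ℚ._+_ (trans (coeff-scale g 1ℚ (φ (Pᶻ k₁ k₂))) (ℚP.*-identityˡ (coeff g (φ (Pᶻ k₁ k₂)))))
                       (trans (∑-map (termCoeff g) zetaTerm R) (∑-cong split R)) ⟩
      coeff g (φ (Pᶻ k₁ k₂)) ℚ.+ ∑ (λ j → pairPart j ℚ.+ (lastIs1 j ℚ.+ (firstIs1 j ℚ.+ firstIs2 j))) R
        ≡⟨ cong (coeff g (φ (Pᶻ k₁ k₂)) ℚ.+_) (trans (∑-+ pairPart _ R)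
             (cong (∑ pairPart R ℚ.+_) (trans (∑-+ lastIs1 _ R) (cong (∑ lastIs1 R ℚ.+_) (∑-+ firstIs1 firstIs2 R))))) ⟩
      coeff g (φ (Pᶻ k₁ k₂)) ℚ.+ (∑ pairPart R ℚ.+ (∑ lastIs1 R ℚ.+ (∑ firstIs1 R ℚ.+ ∑ firstIs2 R))) ∎
      where
      open ≡-Reasoning
      split : ∀ j → termCoeff g (zetaTerm j)
                   ≡ pairPart j ℚ.+ (lastIs1 j ℚ.+ (firstIs1 j ℚ.+ firstIs2 j))
      split j = cong (λ t → pairPart j ℚ.+ (lastIs1 j ℚ.+ (firstIs1 j ℚ.+ t))) (ℚP.+-identityʳ (firstIs2 j))

    coeff-eRel₂ : coeff g (eRel₂ k₁ k₂ 0 0) ≡ 1ℚ ℚ.* ι (Pᵉ k₁ k₂ 0 0) ℚ.+ (∑ pairPart R ℚ.+ ℚ.- c ℚ.* ι (G₁ n 1))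
    coeff-eRel₂ = cong (1ℚ ℚ.* ι (Pᵉ k₁ k₂ 0 0) ℚ.+_) (trans (coeff-++ g (concatMap pairTerm R) lastTerm)
      (cong₂ ℚ._+_ (trans (coeff-concatMap g pairTerm R) (∑-cong coeff-pairTerm R)) coeff-lastTerm))
      where
      pairTerm : ℕ → Formal EGen
      pairTerm l = (ℚ.- ((binom (l ∸ 1) p ℤ.* ℤ.+ 1 ℤ.* ℤ.+ 1 ℤ.+ binom (l ∸ 1) q ℤ.* ℤ.+ 1 ℤ.* ℤ.+ 1) / 1)
                   , G₂ l (K ∸ l) 0 0) ∷ []
      lastTerm : Formal EGen
      lastTerm = (ℚ.- fromℕ (1 * 1 * ((K ∸ 2) C p)) , G₁ n 1) ∷ []
      *1*1 : ∀ x → x ℤ.* ℤ.+ 1 ℤ.* ℤ.+ 1 ≡ x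
      *1*1 x = trans (ℤP.*-identityʳ (x ℤ.* ℤ.+ 1)) (ℤP.*-identityʳ x)
      coeff-pairTerm : ∀ l → coeff g (pairTerm l) ≡ pairPart l
      coeff-pairTerm l = trans (ℚP.+-identityʳ _) (cong (ℚ._* ι (G₂ l (K ∸ l) 0 0))
        (trans (cong (λ z → ℚ.- (z / 1)) (cong₂ ℤ._+_ (*1*1 (binom (l ∸ 1) p)) (*1*1 (binom (l ∸ 1) q))))
               (sym (ℚP.*-identityʳ (ℚ.- β l)))))
      coeff-lastTerm : coeff g lastTerm ≡ ℚ.- c ℚ.* ι (G₁ n 1)
      coeff-lastTerm = trans (ℚP.+-identityʳ _) (cong (λ m → ℚ.- fromℕ m ℚ.* ι (G₁ n 1)) (ℕP.*-identityˡ ((K ∸ 2) C p)))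

    δ-k₁k₂≡0 : 1 ≤ p + q → δ (k₁ * k₂) 1 ≡ 0ℚ
    δ-k₁k₂≡0 1≤p+q = δ-≢ λ k₁k₂≡1 → ℕP.<⇒≢ 1≤p+q (sym (cong₂ _+_
      (ℕP.suc-injective (ℕP.m*n≡1⇒m≡1 k₁ k₂ k₁k₂≡1)) (ℕP.suc-injective (ℕP.m*n≡1⇒n≡1 k₁ k₂ k₁k₂≡1))))

    coeff-φPᶻ : 1 ≤ p + q → coeff g (φ (Pᶻ k₁ k₂)) ≡ 1ℚ ℚ.* ι (Pᵉ k₁ k₂ 0 0) ℚ.+
      (½ ℚ.* δ k₁ 2 ℚ.* ι (G₁ n 1) ℚ.+ (½ ℚ.* δ k₂ 2 ℚ.* ι (G₁ n 1) ℚ.+ (ℚ.- 0ℚ ℚ.* ι (G₁ 2 0) ℚ.+ 0ℚ)))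
    coeff-φPᶻ 1≤p+q = cong₂ (λ u v → 1ℚ ℚ.* ι (Pᵉ k₁ k₂ 0 0) ℚ.+ (u ℚ.+ v))
      (δ-cong ½ k₁ 2 (λ { refl → refl }))
      (cong₂ (λ u d → u ℚ.+ (ℚ.- d ℚ.* ι (G₁ 2 0) ℚ.+ 0ℚ))
        (δ-cong ½ k₂ 2 (λ { refl → cong (λ m → ι (G₁ m 1)) (ℕP.+-comm 2 p) }))
        (δ-k₁k₂≡0 1≤p+q))

    β-top : β n ≡ c ℚ.+ c
    β-top = trans (fromℕ-+ ((K ∸ 2) C p) ((K ∸ 2) C q)) (cong (λ m → c ℚ.+ fromℕ m) C-sym)
      where
      C-sym : (K ∸ 2) C q ≡ (K ∸ 2) C p
      C-sym rewrite K∸2≡p+q = trans (nCk≡nC[n∸k] (ℕP.m≤n+m q p)) (cong ((p + q) C_) (ℕP.m+n∸n≡m p q))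

    β-two : β 2 ≡ β 1 ℚ.+ (δ k₁ 2 ℚ.+ δ k₂ 2)
    β-two = begin
      fromℕ (1 C p + 1 C q)                                         ≡⟨ fromℕ-+ (1 C p) (1 C q) ⟩
      fromℕ (1 C p) ℚ.+ fromℕ (1 C q)                               ≡⟨ cong₂ ℚ._+_ (fromℕ-1Cp p) (fromℕ-1Cp q) ⟩
      (fromℕ (0 C p) ℚ.+ δ k₁ 2) ℚ.+ (fromℕ (0 C q) ℚ.+ δ k₂ 2)     ≡⟨ interchange (fromℕ (0 C p)) (δ k₁ 2) (fromℕ (0 C q)) (δ k₂ 2) ⟩
      (fromℕ (0 C p) ℚ.+ fromℕ (0 C q)) ℚ.+ (δ k₁ 2 ℚ.+ δ k₂ 2)     ≡⟨ cong (ℚ._+ (δ k₁ 2 ℚ.+ δ k₂ 2)) (fromℕ-+ (0 C p) (0 C q)) ⟨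
      β 1 ℚ.+ (δ k₁ 2 ℚ.+ δ k₂ 2)                                   ∎
      where open ≡-Reasoning

    ∑-lastIs1 : ∑ lastIs1 R ≡ ℚ.- β n ℚ.* ½ ℚ.* ι (G₁ n 1)
    ∑-lastIs1 = begin
      ∑ lastIs1 R             ≡⟨ ∑-range-single lastIs1 1 n (p + q) off (ℕP.≤-reflexive (sym n≡1+[p+q])) ⟩
      lastIs1 (suc (p + q))   ≡⟨ cong lastIs1 n≡1+[p+q] ⟨
      lastIs1 n               ≡⟨ cong (λ d → ℚ.- β n ℚ.* (½ ℚ.* d) ℚ.* ι (G₁ n 1)) (cong (λ m → δ m 1) (ℕP.m+n∸n≡m 1 n)) ⟩
      ℚ.- β n ℚ.* ½ ℚ.* ι (G₁ n 1) ∎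
      where
      open ≡-Reasoning
      off : ∀ j → j ≢ p + q → lastIs1 (suc j) ≡ 0ℚ
      off j j≢p+q = δ-term-vanishes (ℚ.- β (suc j)) (ι (G₁ (suc j) 1)) (½ ℚ.*_) refl
        (λ n∸j≡1 → j≢p+q (ℕP.suc-injective (trans (sym (∸≡1⇒≡suc n j n∸j≡1)) n≡1+[p+q])))

    ∑-firstIs1 : ∑ firstIs1 R ≡ ℚ.- β 1 ℚ.* ℚ.- ½ ℚ.* ι (G₁ n 1)
    ∑-firstIs1 = ∑-range-single firstIs1 1 n 0 off (subst (0 <_) (sym n≡1+[p+q]) (s≤s z≤n))
      where
      off : ∀ j → j ≢ 0 → firstIs1 (suc j) ≡ 0ℚ
      off j j≢0 = δ-term-vanishes (ℚ.- β (suc j)) (ι (G₁ (K ∸ suc j) 1)) (λ d → ℚ.- (½ ℚ.* d)) refl (j≢0 ∘ ℕP.suc-injective)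

    ∑-firstIs2 : 1 ≤ p + q → ∑ firstIs2 R ≡ ℚ.- β 2 ℚ.* ½ ℚ.* ι (G₁ n 1)
    ∑-firstIs2 1≤p+q = begin
      ∑ firstIs2 R   ≡⟨ ∑-range-single firstIs2 1 n 1 off (subst (1 <_) (sym n≡1+[p+q]) (s≤s 1≤p+q)) ⟩
      firstIs2 2     ≡⟨ cong (λ m → ℚ.- β 2 ℚ.* ½ ℚ.* ι (G₁ m 1)) (trans (cong suc K∸2≡p+q) (sym n≡1+[p+q])) ⟩
      ℚ.- β 2 ℚ.* ½ ℚ.* ι (G₁ n 1) ∎
      where
      open ≡-Reasoning
      off : ∀ j → j ≢ 1 → firstIs2 (suc j) ≡ 0ℚ
      off j j≢1 = δ-term-vanishes (ℚ.- β (suc j)) (ι (G₁ (suc (K ∸ suc j)) 1)) (½ ℚ.*_) refl (j≢1 ∘ ℕP.suc-injective)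

  φ*-zRel₂ : 1 ≤ p + q → coeff g (φ* (zRel₂ (suc p) (suc q))) ≡ coeff g (eRel₂ (suc p) (suc q) 0 0)
  φ*-zRel₂ 1≤p+q = begin
    coeff g (φ* (zRel₂ k₁ k₂))
      ≡⟨ coeff-φ*-zRel₂ ⟩
    coeff g (φ (Pᶻ k₁ k₂)) ℚ.+ (∑ pairPart R ℚ.+ (∑ lastIs1 R ℚ.+ (∑ firstIs1 R ℚ.+ ∑ firstIs2 R)))
      ≡⟨ cong₂ ℚ._+_ (coeff-φPᶻ 1≤p+q)
           (cong (∑ pairPart R ℚ.+_) (cong₂ ℚ._+_ ∑-lastIs1 (cong₂ ℚ._+_ ∑-firstIs1 (∑-firstIs2 1≤p+q)))) ⟩
    _ ≡⟨ boundary-cancel (ι (Pᵉ k₁ k₂ 0 0)) (ι (G₁ n 1)) (ι (G₁ 2 0)) (∑ pairPart R)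
                         (δ k₁ 2) (δ k₂ 2) (β 1) (β 2) (β n) c β-top β-two ⟩
    1ℚ ℚ.* ι (Pᵉ k₁ k₂ 0 0) ℚ.+ (∑ pairPart R ℚ.+ ℚ.- c ℚ.* ι (G₁ n 1))
      ≡⟨ coeff-eRel₂ ⟨
    coeff g (eRel₂ k₁ k₂ 0 0) ∎
    where open ≡-Reasoning

validERel : ∀ p q w → ValidERel (suc p + suc q) (erel w (suc p) (suc q) 0 0)
validERel p q w = s≤s z≤n , s≤s z≤n , +0+0 (suc p + suc q)

zRel₁-in-span : ∀ p q → InRelSpanE (suc p + suc q) (φ* (zRel₁ (suc p) (suc q)))
zRel₁-in-span p q = inRelSpan-single (φ* (zRel₁ (suc p) (suc q))) (erel first (suc p) (suc q) 0 0) (validERel p q first) (φ*-zRel₁ p q)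

zRel₂-in-span : ∀ p q → InRelSpanE (suc p + suc q) (φ* (zRel₂ (suc p) (suc q)))
zRel₂-in-span zero zero = inRelSpan-single (φ* (zRel₂ 1 1)) (erel first 1 1 0 0) (validERel 0 0 first) φ*-zRel₂-1-1
zRel₂-in-span zero (suc q) = inRelSpan-single (φ* (zRel₂ 1 (suc (suc q))))
  (erel second 1 (suc (suc q)) 0 0) (validERel 0 (suc q) second) (λ g → φ*-zRel₂ 0 (suc q) g (s≤s z≤n))
zRel₂-in-span (suc p) q = inRelSpan-single (φ* (zRel₂ (suc (suc p)) (suc q)))
  (erel second (suc (suc p)) (suc q) 0 0) (validERel (suc p) q second) (λ g → φ*-zRel₂ (suc p) q g (s≤s z≤n))

proposition3p2 : (k : ℕ) → 1 ≤ k →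
    -- (i) the images of the weight-k symbols lie in 𝒟ℰ_k (span of weight-k symbols)
    ((g : ZGen) → ValidZGen k g → (h : EGen) → ¬ ValidEGen k h → coeffE h (φ g) ≡ 0ℚ)
    -- (ii) every defining relation of 𝒟𝒵_k is sent into the span of those of 𝒟ℰ_k
    × ((k₁ k₂ : ℕ) → 1 ≤ k₁ → 1 ≤ k₂ → k₁ + k₂ ≡ k →
         InRelSpanE k (φ* (zRel₁ k₁ k₂)) × InRelSpanE k (φ* (zRel₂ k₁ k₂)))
proposition3p2 k 1≤k =
  (λ g g-valid h h-invalid → coeffE-supported (ValidEGen k) h-invalid (φ g) (φ-supported 1≤k g g-valid))
  , λ { zero _ () _ _
      ; _ zero _ () _
      ; (suc p) (suc q) _ _ refl → zRel₁-in-span p q , zRel₂-in-span p q }
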